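{- Let $M\in\widehat{\mathcal M}$, let $q=\Phi^{ -1}(M)\in\widehat{\mathcal Q}$ and $M'=\Lambda(M)=\Phi^-(q)$, with $M$ and $M'$ considered as superimposed (both drawn inside the faces of $q$). Let $u$ be a vertex of $M'$ with label $i$, and let $e_1,e_2$ be two edges of $M'$ incident to $u$ whose other extremities $v$ and $w$ both have label $i+1$. Let $S$ be the clockwise angular sector around $u$ going from $e_1$ to $e_2$. Then there is an edge of $M$ leaving $u$ in the sector $S$ and ending at a vertex of label $i-1$.
   Context: A map is a connected graph (loops and multiple edges allowed) embedded in the sphere, considered up to orientation-preserving homeomorphism. A well-labelled map is a map together with $\ell:V\to\mathbb Z$ such that $|\ell(u)-\ell(v)|\le 1$ for every edge $\{u,v\}$; it is very-well-labelled if $|\ell(u)-\ell(v)|=1$ for every edge. A vertex is a local max (resp. local min) if its label is not smaller (resp. not larger) than the label of any of its neighbours. A quadrangulation is a map all of whose faces have degree 4. Let $\widehat{\mathcal M}$ be the set of well-labelled maps and $\widehat{\mathcal Q}$ the set of very-well-labelled quadrangulations. In $q\in\widehat{\mathcal Q}$, reading the labels of the four corners of a face in clockwise order around the face (as seen from inside the face), one gets cyclically either $(l,l+1,l,l+1)$ or $(l,l+1,l+2,l+1)$ for some integer $l$. The map $\Phi(q)$ is obtained by drawing inside each face one new edge: in a face of type $(l,l+1,l,l+1)$ join the two corners labelled $l$; in a face whose corners in clockwise order are $a,b,c,d$ with labels $l,l+1,l+2,l+1$, join $a$ to $d$; then all edges of $q$ and all local max of $q$ are deleted (remaining vertices keep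 their labels). The map $\Phi^-(q)$ is obtained by drawing inside each face: in a face of type $(l,l+1,l,l+1)$ an edge joining the two corners labelled $l+1$; in a face with clockwise corners $a,b,c,d$ labelled $l,l+1,l+2,l+1$, an edge joining $c$ to $b$; then all edges of $q$ and all local min of $q$ are deleted. $\Phi$ and $\Phi^-$ are bijections $\widehat{\mathcal Q}\to\widehat{\mathcal M}$ (Ambjørn–Budd), and $\Lambda=\Phi^-\circ\Phi^{ -1}:\widehat{\mathcal M}\to\widehat{\mathcal M}$. -}

module Defs where

open import Data.Nat as ℕ using (ℕ; zero; suc)
open import Data.Fin using (Fin; toℕ)
open import Data.Integer as ℤ using (ℤ; ∣_∣; 1ℤ)
open import Data.Product using (Σ; ∃; ∃₂; _×_; _,_)
open import Data.Sum using (_⊎_)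
open import Data.List using (List; length; filter; upTo; allFin)
open import Data.List.Relation.Unary.All using (All; all?)
open import Relation.Binary.PropositionalEquality using (_≡_; _≢_)
open import Function using (_∘_)

-- Darts (half-edges) are Fin n.
--  σ  : rotation of darts COUNTERCLOCKWISE around their origin vertex
--  α  : fixed-point-free involution (the other half of the edge)
--  φ = σ ∘ α : face permutation; with these conventions each φ-orbit
--       traverses its face CLOCKWISE (the face lies to the right of
--       every dart of its orbit).
-- Vertices = σ-orbits, edges = α-orbits, faces = φ-orbits.

iter : {A : Set} → (A → A) → ℕ → A → A
iter f zero x = x
iter f (suc k) x = f (iter f k x)

-- number of orbits of f on Fin n: count darts that are the least element
-- (w.r.t. toℕ) of their orbit (orbits of a permutation of Fin n have size ≤ n)
numOrbits : ∀ {n} → (Fin n → Fin n) → ℕ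
numOrbits {n} f =
  length (filter (λ d → all? (λ k → toℕ d ℕ.≤? toℕ (iter f k d)) (upTo n)) (allFin n))

-- reachability in the group generated by σ and α (σ is a permutation of a
-- finite set, so forward steps suffice)
data Conn {n} (σ α : Fin n → Fin n) (d : Fin n) : Fin n → Set where
  here  : Conn σ α d d
  stepσ : ∀ {e} → Conn σ α d e → Conn σ α d (σ e)
  stepα : ∀ {e} → Conn σ α d e → Conn σ α d (α e)

record Map (n : ℕ) : Set where
  field
    σ σ⁻ α   : Fin n → Fin n
    σσ⁻      : ∀ d → σ (σ⁻ d) ≡ d
    σ⁻σ      : ∀ d → σ⁻ (σ d) ≡ d
    αα       : ∀ d → α (α d) ≡ d
    α-fpf    : ∀ d → α d ≢ d
    connected : ∀ d e → Conn σ α d e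
    -- Euler: V - E + F = 2 with E = n/2, i.e. 2V + 2F = n + 4 (genus 0)
    spherical : 2 ℕ.* (numOrbits σ ℕ.+ numOrbits (σ ∘ α)) ≡ n ℕ.+ 4
  φ : Fin n → Fin n
  φ = σ ∘ α

-- a very-well-labelled quadrangulation.  The label of a dart is the label
-- of its origin vertex (hence constant on σ-orbits).
record VWLQuad (n : ℕ) : Set where
  field
    map : Map n
  open Map map public
  field
    ℓ     : Fin n → ℤ
    ℓ-σ   : ∀ d → ℓ (σ d) ≡ ℓ d
    quad  : ∀ d → iter φ 4 d ≡ d × φ d ≢ d × iter φ 2 d ≢ d
    vwl   : ∀ d → ∣ ℓ (α d) ℤ.- ℓ d ∣ ≡ 1

module _ {n} (q : VWLQuad n) where
  open VWLQuad q

  -- Corners: dart d represents the corner at origin(d) between σ⁻ d and d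
  -- (counterclockwise), which lies in the face (φ-orbit) of d.  The corners
  -- of that face in clockwise order are d, φ d, φ² d, φ³ d.

  Type1 : Fin n → ℤ → Set
  Type1 a l = ℓ a ≡ l × ℓ (iter φ 1 a) ≡ l ℤ.+ 1ℤ
            × ℓ (iter φ 2 a) ≡ l × ℓ (iter φ 3 a) ≡ l ℤ.+ 1ℤ

  Type2 : Fin n → ℤ → Set
  Type2 a l = ℓ a ≡ l × ℓ (iter φ 1 a) ≡ l ℤ.+ 1ℤ
            × ℓ (iter φ 2 a) ≡ l ℤ.+ (1ℤ ℤ.+ 1ℤ) × ℓ (iter φ 3 a) ≡ l ℤ.+ 1ℤ

  ΦEdge : Fin n → Fin n → Set
  ΦEdge x y = ∃₂ λ a l →
      (Type1 a l × ((x ≡ a × y ≡ iter φ 2 a) ⊎ (y ≡ a × x ≡ iter φ 2 a)))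
    ⊎ (Type2 a l × ((x ≡ a × y ≡ iter φ 3 a) ⊎ (y ≡ a × x ≡ iter φ 3 a)))

  Φ⁻Edge : Fin n → Fin n → Set
  Φ⁻Edge x y = ∃₂ λ a l →
      (Type1 a l × ((x ≡ iter φ 1 a × y ≡ iter φ 3 a) ⊎ (y ≡ iter φ 1 a × x ≡ iter φ 3 a)))
    ⊎ (Type2 a l × ((x ≡ iter φ 2 a × y ≡ iter φ 1 a) ⊎ (y ≡ iter φ 2 a × x ≡ iter φ 1 a)))

  -- corner d lies strictly inside the clockwise angular sector around the
  -- common vertex going from corner d₁ to corner d₂ (clockwise = σ⁻ steps)
  InCwSector : Fin n → Fin n → Fin n → Set
  InCwSector d₁ d₂ d = ∃₂ λ k K →
      0 ℕ.< k × k ℕ.< K × iter σ⁻ K d₁ ≡ d₂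
    × (∀ j → 0 ℕ.< j → j ℕ.< K → iter σ⁻ j d₁ ≢ d₂)
    × iter σ⁻ k d₁ ≡ d

-- Read the edges of q at u clockwise from e₁ to e₂.  An edge of Φ⁻(q) going up
-- from u forces the q-edge at its corner to go up and the next one clockwise to
-- go down, so the sector starts with a descending q-edge and ends with an
-- ascending one.  Somewhere in between a descending edge is followed clockwise
-- by an ascending one; the face of q between them is labelled i-1, i, i+1, i,
-- and its edge of Φ(q) joins u to the corner labelled i-1.

module Submission where

open import Defs
open import Data.Nat using (ℕ)
open import Data.Fin using (Fin)
open import Data.Integer using (ℤ; _+_; _-_; 1ℤ)
open import Data.Product using (∃; ∃₂; _×_)
open import Relation.Binary.PropositionalEquality using (_≡_; _≢_)

open import Data.Nat as ℕ using (zero; suc; _<_; z≤n; s≤s)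
import Data.Nat.Properties as ℕ
open import Data.Fin as Fin using (toℕ)
import Data.Fin.Properties as Fin
open import Data.Integer as ℤ using (+_; -[1+_]; 0ℤ; -1ℤ; ∣_∣)
open import Data.Integer.Properties as ℤ using (+-0-abelianGroup)
open import Data.Integer.Tactic.RingSolver using (solve-∀)
open import Algebra.Properties.AbelianGroup +-0-abelianGroup using (∙-cancelˡ)
open import Data.Product using (_,_; proj₁)
open import Data.Sum as Sum using (_⊎_; inj₁; inj₂)
open import Data.Empty using (⊥; ⊥-elim)
open import Function using (_∘_)
open import Function.Definitions using (Injective)
open import Relation.Nullary using (¬_; yes; no; contradiction)
open import Relation.Unary using (Decidable)
open import Relation.Binary.PropositionalEquality using (refl; sym; trans; cong; subst; module ≡-Reasoning)
open ≡-Reasoning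

iter-+ : ∀ {A : Set} (f : A → A) m k x → iter f (m ℕ.+ k) x ≡ iter f m (iter f k x)
iter-+ f zero    k x = refl
iter-+ f (suc m) k x = cong f (iter-+ f m k x)

iter-sucʳ : ∀ {A : Set} (f : A → A) k x → iter f (suc k) x ≡ iter f k (f x)
iter-sucʳ f zero    x = refl
iter-sucʳ f (suc k) x = cong f (iter-sucʳ f k x)

iter-injective : ∀ {A : Set} {f : A → A} → Injective _≡_ _≡_ f → ∀ m → Injective _≡_ _≡_ (iter f m)
iter-injective f-inj zero    eq = eq
iter-injective f-inj (suc m) eq = iter-injective f-inj m (f-inj eq)

iter-inverseˡ : ∀ {A : Set} {f g : A → A} → (∀ x → g (f x) ≡ x) → ∀ k x → iter g k (iter f k x) ≡ x
iter-inverseˡ gf zero    x = refl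
iter-inverseˡ {f = f} {g} gf (suc k) x = begin
  iter g (suc k) (f (iter f k x))  ≡⟨ iter-sucʳ g k _ ⟩
  iter g k (g (f (iter f k x)))    ≡⟨ cong (iter g k) (gf _) ⟩
  iter g k (iter f k x)            ≡⟨ iter-inverseˡ gf k x ⟩
  x                                ∎

iter-*-periodic : ∀ {A : Set} (f : A → A) p x → iter f p x ≡ x → ∀ m → iter f (m ℕ.* p) x ≡ x
iter-*-periodic f p x fᵖx≡x zero    = refl
iter-*-periodic f p x fᵖx≡x (suc m) = begin
  iter f (p ℕ.+ m ℕ.* p) x        ≡⟨ iter-+ f p (m ℕ.* p) x ⟩
  iter f p (iter f (m ℕ.* p) x)   ≡⟨ cong (iter f p) (iter-*-periodic f p x fᵖx≡x m) ⟩
  iter f p x                      ≡⟨ fᵖx≡x ⟩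
  x                               ∎

-- Among x, f x, …, fⁿ x two coincide; injectivity cancels the common prefix.
iter-periodic : ∀ {n} {f : Fin n → Fin n} → Injective _≡_ _≡_ f → ∀ x → ∃ λ p → iter f (suc p) x ≡ x
iter-periodic {n} {f} f-inj x
  with i , j , i<j , fⁱx≡fʲx ← Fin.pigeonhole (ℕ.n<1+n n) (λ t → iter f (toℕ t) x)
  with o , i+1+o≡j ← ℕ.m≤n⇒∃[o]m+o≡n i<j
  = o , sym (iter-injective f-inj (toℕ i) (begin
      iter f (toℕ i) x                    ≡⟨ fⁱx≡fʲx ⟩
      iter f (toℕ j) x                    ≡⟨ cong (λ m → iter f m x) (trans (sym i+1+o≡j) (sym (ℕ.+-suc (toℕ i) o))) ⟩
      iter f (toℕ i ℕ.+ suc o) x          ≡⟨ iter-+ f (toℕ i) (suc o) x ⟩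
      iter f (toℕ i) (iter f (suc o) x)   ∎))

iter-inverse-reachable : ∀ {n} {f g : Fin n → Fin n} → (∀ x → f (g x) ≡ x) → (∀ x → g (f x) ≡ x) →
  ∀ k {x y} → iter f k x ≡ y → ∃ λ m → iter g m x ≡ y
iter-inverse-reachable {f = f} {g} fg gf k {x} {y} fᵏx≡y
  = let p , gᵖ⁺¹y≡y = iter-periodic g-injective y in
    k ℕ.* p , (begin
    iter g (k ℕ.* p) x                ≡⟨ cong (iter g (k ℕ.* p)) x≡gᵏy ⟩
    iter g (k ℕ.* p) (iter g k y)     ≡⟨ iter-+ g (k ℕ.* p) k y ⟨
    iter g (k ℕ.* p ℕ.+ k) y          ≡⟨ cong (λ m → iter g m y) (trans (ℕ.+-comm (k ℕ.* p) k) (sym (ℕ.*-suc k p))) ⟩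
    iter g (k ℕ.* suc p) y            ≡⟨ iter-*-periodic g (suc p) y gᵖ⁺¹y≡y k ⟩
    y                                 ∎)
  where
  g-injective : Injective _≡_ _≡_ g
  g-injective {a} {b} ga≡gb = trans (sym (fg a)) (trans (cong f ga≡gb) (fg b))
  x≡gᵏy : x ≡ iter g k y
  x≡gᵏy = trans (sym (iter-inverseˡ gf k x)) (cong (iter g k) fᵏx≡y)

least-witness : ∀ {P : ℕ → Set} → Decidable P → ∀ {m} → P m →
  ∃ λ k → P k × (∀ {j} → j < k → ¬ P j)
least-witness {P} P? {m} Pm = search m 0 (ℕ.+-identityʳ m) (λ ())
  where
  search : ∀ b k → b ℕ.+ k ≡ m → (∀ {j} → j < k → ¬ P j) → ∃ λ k → P k × (∀ {j} → j < k → ¬ P j)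
  search b k b+k≡m none with P? k
  ... | yes Pk = k , Pk , none
  search zero    k refl      none | no ¬Pk = contradiction Pm ¬Pk
  search (suc b) k 1+b+k≡m none | no ¬Pk =
    search b (suc k) (trans (ℕ.+-suc b k) 1+b+k≡m) none′
    where
    none′ : ∀ {j} → j < suc k → ¬ P j
    none′ j<1+k with ℕ.m<1+n⇒m<n∨m≡n j<1+k
    ... | inj₁ j<k  = none j<k
    ... | inj₂ refl = ¬Pk

exit-point : ∀ {Q : ℕ → Set} → Decidable Q → Q 0 → ∀ N → ¬ Q N →
  ∃ λ t → t < N × Q t × ¬ Q (suc t)
exit-point Q? Q0 zero    ¬QN = contradiction Q0 ¬QN
exit-point Q? Q0 (suc N) ¬Q1+N with Q? N
... | yes QN  = N , ℕ.n<1+n N , QN , ¬Q1+N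
... | no  ¬QN =
  let t , t<N , Qt , ¬Q1+t = exit-point Q? Q0 N ¬QN
  in  t , ℕ.m<n⇒m<1+n t<N , Qt , ¬Q1+t

first-hit : ∀ {n} {f g : Fin n → Fin n} → (∀ x → f (g x) ≡ x) → (∀ x → g (f x) ≡ x) →
  ∀ k {x y} → iter f k x ≡ y → x ≢ y →
  ∃ λ N → iter g (suc N) x ≡ y × (∀ j → 0 < j → j < suc N → iter g j x ≢ y)
first-hit {g = g} fg gf k {x} {y} fᵏx≡y x≢y
  with m , gᵐx≡y ← iter-inverse-reachable fg gf k fᵏx≡y
  with least-witness (λ j → iter g j x Fin.≟ y) {m} gᵐx≡y
... | zero  , x≡y   , _      = contradiction x≡y x≢y
... | suc N , gᴷx≡y , before = N , gᴷx≡y , λ j _ j<K → before j<K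

private
  j+[i-j]≡i : ∀ i j → j + (i - j) ≡ i
  j+[i-j]≡i = solve-∀

  i≢i+1 : ∀ i → i ≢ i + 1ℤ
  i≢i+1 i eq with () ← ∙-cancelˡ i 0ℤ 1ℤ (trans (ℤ.+-identityʳ i) eq)

  i≢[i+1]+1 : ∀ i → i ≢ (i + 1ℤ) + 1ℤ
  i≢[i+1]+1 i eq with () ← ∙-cancelˡ i 0ℤ (+ 2) (trans (ℤ.+-identityʳ i) (trans eq (ℤ.+-assoc i 1ℤ 1ℤ)))

  i+1≢i-1 : ∀ i → i + 1ℤ ≢ i - 1ℤ
  i+1≢i-1 i eq with () ← ∙-cancelˡ i 1ℤ -1ℤ eq

  i+1≢i-3 : ∀ i → i + 1ℤ ≢ i + -[1+ 2 ]
  i+1≢i-3 i eq with () ← ∙-cancelˡ i 1ℤ -[1+ 2 ] eq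

  [[i-1]-1]+1≡i-1 : ∀ i → ((i - 1ℤ) - 1ℤ) + 1ℤ ≡ i - 1ℤ
  [[i-1]-1]+1≡i-1 = solve-∀

  [[i-1]-1]-1≡i-3 : ∀ i → ((i - 1ℤ) - 1ℤ) - 1ℤ ≡ i + -[1+ 2 ]
  [[i-1]-1]-1≡i-3 = solve-∀

  [i+1]-1≡i : ∀ i → (i + 1ℤ) - 1ℤ ≡ i
  [i+1]-1≡i = solve-∀

  i+1≡[i-1]+2 : ∀ i → i + 1ℤ ≡ (i - 1ℤ) + (1ℤ + 1ℤ)
  i+1≡[i-1]+2 = solve-∀

  i≡[i-1]+1 : ∀ i → i ≡ (i - 1ℤ) + 1ℤ
  i≡[i-1]+1 = solve-∀

∣k∣≡1⇒k≡±1 : ∀ k → ∣ k ∣ ≡ 1 → k ≡ 1ℤ ⊎ k ≡ -1ℤ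
∣k∣≡1⇒k≡±1 (+ .1)     refl = inj₁ refl
∣k∣≡1⇒k≡±1 -[1+ .0 ] refl = inj₂ refl

∣i-j∣≡1⇒i≡j±1 : ∀ i j → ∣ i - j ∣ ≡ 1 → i ≡ j + 1ℤ ⊎ i ≡ j - 1ℤ
∣i-j∣≡1⇒i≡j±1 i j ∣i-j∣≡1 = Sum.map shift shift (∣k∣≡1⇒k≡±1 (i - j) ∣i-j∣≡1)
  where
  shift : ∀ {c} → i - j ≡ c → i ≡ j + c
  shift i-j≡c = trans (sym (j+[i-j]≡i i j)) (cong (λ c → j + c) i-j≡c)

module _ {n} (q : VWLQuad n) where
  open VWLQuad q

  ℓ-σ⁻ : ∀ d → ℓ (σ⁻ d) ≡ ℓ d
  ℓ-σ⁻ d = trans (sym (ℓ-σ (σ⁻ d))) (cong ℓ (σσ⁻ d))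

  ℓ-iter-σ⁻ : ∀ k d → ℓ (iter σ⁻ k d) ≡ ℓ d
  ℓ-iter-σ⁻ zero    d = refl
  ℓ-iter-σ⁻ (suc k) d = trans (ℓ-σ⁻ (iter σ⁻ k d)) (ℓ-iter-σ⁻ k d)

  ℓ-φ : ∀ d → ℓ (φ d) ≡ ℓ (α d)
  ℓ-φ d = ℓ-σ (α d)

  φ-injective : Injective _≡_ _≡_ φ
  φ-injective {x} {y} φx≡φy = begin
    x                ≡⟨ αα x ⟨
    α (α x)          ≡⟨ cong α (σ⁻σ (α x)) ⟨
    α (σ⁻ (φ x))     ≡⟨ cong (α ∘ σ⁻) φx≡φy ⟩
    α (σ⁻ (φ y))     ≡⟨ cong α (σ⁻σ (α y)) ⟩
    α (α y)          ≡⟨ αα y ⟩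
    y                ∎

  φ³≡α∘σ⁻ : ∀ d → iter φ 3 d ≡ α (σ⁻ d)
  φ³≡α∘σ⁻ d = φ-injective (begin
    iter φ 4 d           ≡⟨ proj₁ (quad d) ⟩
    d                    ≡⟨ σσ⁻ d ⟨
    σ (σ⁻ d)             ≡⟨ cong σ (αα (σ⁻ d)) ⟨
    φ (α (σ⁻ d))         ∎)

  Up Down : Fin n → Set
  Up   d = ℓ (α d) ≡ ℓ d + 1ℤ
  Down d = ℓ (α d) ≡ ℓ d - 1ℤ

  Down? : Decidable Down
  Down? d = ℓ (α d) ℤ.≟ ℓ d - 1ℤ

  up⊎down : ∀ d → Up d ⊎ Down d
  up⊎down d = ∣i-j∣≡1⇒i≡j±1 (ℓ (α d)) (ℓ d) (vwl d)

  up⇒¬down : ∀ {d} → Up d → ¬ Down d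
  up⇒¬down {d} up down = i+1≢i-1 (ℓ d) (trans (sym up) down)

  ¬down⇒up : ∀ {d} → ¬ Down d → Up d
  ¬down⇒up {d} ¬down with up⊎down d
  ... | inj₁ up   = up
  ... | inj₂ down = contradiction down ¬down

  -- Only a face of type (l, l+1, l+2, l+1) entered at its second corner gives
  -- an edge of Φ⁻(q) going up from d.
  Φ⁻Edge-up : ∀ {d y} → Φ⁻Edge q d y → ℓ y ≡ ℓ d + 1ℤ → Up d × Down (σ⁻ d)
  Φ⁻Edge-up (a , l , inj₁ ((_ , t1 , _ , t3) , inj₁ (refl , refl))) ℓy≡ℓd+1 =
    contradiction (trans (trans t1 (sym t3)) ℓy≡ℓd+1) (i≢i+1 _)
  Φ⁻Edge-up (a , l , inj₁ ((_ , t1 , _ , t3) , inj₂ (refl , refl))) ℓy≡ℓd+1 =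
    contradiction (trans (trans t3 (sym t1)) ℓy≡ℓd+1) (i≢i+1 _)
  Φ⁻Edge-up (a , l , inj₂ ((_ , t1 , t2 , _) , inj₁ (refl , refl))) ℓy≡ℓd+1 =
    ⊥-elim (i≢[i+1]+1 _ (trans ℓy≡ℓd+1 (cong (_+ 1ℤ) ℓφ²≡ℓφ+1)))
    where
    ℓφ²≡ℓφ+1 : ℓ (iter φ 2 a) ≡ ℓ (φ a) + 1ℤ
    ℓφ²≡ℓφ+1 = trans t2 (trans (sym (ℤ.+-assoc l 1ℤ 1ℤ)) (cong (_+ 1ℤ) (sym t1)))
  Φ⁻Edge-up (a , l , inj₂ ((t0 , t1 , _ , _) , inj₂ (refl , refl))) ℓy≡ℓd+1 =
    trans (sym (ℓ-φ (φ a))) ℓy≡ℓd+1 , (begin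
      ℓ (α (σ⁻ (φ a)))      ≡⟨ cong ℓ (φ³≡α∘σ⁻ (φ a)) ⟨
      ℓ (iter φ 4 a)        ≡⟨ cong ℓ (proj₁ (quad a)) ⟩
      ℓ a                   ≡⟨ t0 ⟩
      l                     ≡⟨ [i+1]-1≡i l ⟨
      (l + 1ℤ) - 1ℤ         ≡⟨ cong (_- 1ℤ) (trans (sym t1) (sym (ℓ-σ⁻ (φ a)))) ⟩
      ℓ (σ⁻ (φ a)) - 1ℤ     ∎)

  -- The face φ e has corners φ e, φ² e, φ³ e, e labelled l, l+1, l+2, l+1 with
  -- l = ℓ e - 1; the middle value is forced since φ³ e is two levels above φ e.
  ΦEdge-down-up : ∀ {e} → Down e → Up (σ⁻ e) → ΦEdge q e (φ e)
  ΦEdge-down-up {e} down up =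
    φ e , ℓ e - 1ℤ , inj₂ (type2 , inj₂ (refl , sym (proj₁ (quad e))))
    where
    ℓφ : ℓ (φ e) ≡ ℓ e - 1ℤ
    ℓφ = trans (ℓ-φ e) down
    ℓφ³ : ℓ (iter φ 3 e) ≡ ℓ e + 1ℤ
    ℓφ³ = trans (cong ℓ (φ³≡α∘σ⁻ e)) (trans up (cong (_+ 1ℤ) (ℓ-σ⁻ e)))
    ℓφ² : ℓ (iter φ 2 e) ≡ (ℓ e - 1ℤ) + 1ℤ
    ℓφ² with up⊎down (φ e)
    ... | inj₁ up′   = trans (ℓ-φ (φ e)) (trans up′ (cong (_+ 1ℤ) ℓφ))
    ... | inj₂ down′ = ⊥-elim (too-far (up⊎down (iter φ 2 e)))
      where
      ℓφ²≡ℓe-2 : ℓ (iter φ 2 e) ≡ (ℓ e - 1ℤ) - 1ℤ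
      ℓφ²≡ℓe-2 = trans (ℓ-φ (φ e)) (trans down′ (cong (_- 1ℤ) ℓφ))
      ℓe+1≡ℓαφ² : ℓ e + 1ℤ ≡ ℓ (α (iter φ 2 e))
      ℓe+1≡ℓαφ² = trans (sym ℓφ³) (ℓ-φ (iter φ 2 e))
      too-far : Up (iter φ 2 e) ⊎ Down (iter φ 2 e) → ⊥
      too-far (inj₁ up″) = i+1≢i-1 (ℓ e) (begin
        ℓ e + 1ℤ                     ≡⟨ trans ℓe+1≡ℓαφ² up″ ⟩
        ℓ (iter φ 2 e) + 1ℤ          ≡⟨ cong (_+ 1ℤ) ℓφ²≡ℓe-2 ⟩
        ((ℓ e - 1ℤ) - 1ℤ) + 1ℤ       ≡⟨ [[i-1]-1]+1≡i-1 (ℓ e) ⟩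
        ℓ e - 1ℤ                     ∎)
      too-far (inj₂ down″) = i+1≢i-3 (ℓ e) (begin
        ℓ e + 1ℤ                     ≡⟨ trans ℓe+1≡ℓαφ² down″ ⟩
        ℓ (iter φ 2 e) - 1ℤ          ≡⟨ cong (_- 1ℤ) ℓφ²≡ℓe-2 ⟩
        ((ℓ e - 1ℤ) - 1ℤ) - 1ℤ       ≡⟨ [[i-1]-1]-1≡i-3 (ℓ e) ⟩
        ℓ e + -[1+ 2 ]               ∎)
    type2 : Type2 q (φ e) (ℓ e - 1ℤ)
    type2 = ℓφ , ℓφ² , trans ℓφ³ (i+1≡[i-1]+2 (ℓ e))
          , trans (cong ℓ (proj₁ (quad e))) (i≡[i-1]+1 (ℓ e))

  descent-in-sector : ∀ {d} N → Down (σ⁻ d) → Up (iter σ⁻ (suc N) d) →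
    ∃ λ t → t < N × Down (iter σ⁻ (suc t) d) × Up (iter σ⁻ (suc (suc t)) d)
  descent-in-sector {d} N down₀ upₙ =
    let t , t<N , down , ¬down = exit-point (λ t → Down? (iter σ⁻ (suc t) d)) down₀ N (up⇒¬down upₙ)
    in  t , t<N , down , ¬down⇒up ¬down

lemma1 : ∀ {n} (q : VWLQuad n) (i : ℤ) (d₁ d₂ y₁ y₂ : Fin n) →
    VWLQuad.ℓ q d₁ ≡ i →
    ∃ (λ k → iter (VWLQuad.σ q) k d₁ ≡ d₂) →
    d₁ ≢ d₂ →
    Φ⁻Edge q d₁ y₁ → VWLQuad.ℓ q y₁ ≡ i + 1ℤ →
    Φ⁻Edge q d₂ y₂ → VWLQuad.ℓ q y₂ ≡ i + 1ℤ →
    ∃₂ λ d y → InCwSector q d₁ d₂ d × ΦEdge q d y × VWLQuad.ℓ q y ≡ i - 1ℤ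
lemma1 q i d₁ d₂ y₁ y₂ refl (k , σᵏd₁≡d₂) d₁≢d₂ d₁—y₁ ℓy₁ d₂—y₂ ℓy₂ =
  let open VWLQuad q
      N , σ⁻ᴺ⁺¹d₁≡d₂ , d₂-first = first-hit σσ⁻ σ⁻σ k σᵏd₁≡d₂ d₁≢d₂
      ℓd₂≡ℓd₁ = trans (cong ℓ (sym σ⁻ᴺ⁺¹d₁≡d₂)) (ℓ-iter-σ⁻ q (suc N) d₁)
      _   , down₁ = Φ⁻Edge-up q d₁—y₁ ℓy₁
      up₂ , _     = Φ⁻Edge-up q d₂—y₂ (trans ℓy₂ (cong (_+ 1ℤ) (sym ℓd₂≡ℓd₁)))
      t , t<N , down , up = descent-in-sector q N down₁ (subst (Up q) (sym σ⁻ᴺ⁺¹d₁≡d₂) up₂)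
      e = iter σ⁻ (suc t) d₁
  in  e , φ e , (suc t , suc N , s≤s z≤n , s≤s t<N , σ⁻ᴺ⁺¹d₁≡d₂ , d₂-first , refl)
      , ΦEdge-down-up q down up
      , trans (ℓ-φ q e) (trans down (cong (_- 1ℤ) (ℓ-iter-σ⁻ q (suc t) d₁)))
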